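{- (a) Let $k\ge 3$. Over the range $F_k\le n<F_{k+1}$, the sequence $a(n)$ achieves its minimum uniquely at $n=F_k$. (b) Let $k\ge 5$. Over the range $F_k\le n<F_{k+1}$, the sequence $a(n)$ achieves its maximum only at $n=F_k+1$ and $n=F_k+2$.
   Context: Fibonacci numbers: $F_0=0$, $F_1=1$, $F_n=F_{n-1}+F_{n-2}$. The sequence $(a(n))_{n\geq 0}$ (OEIS A105774) is defined by $a(n)=n$ for $n\le 1$, and $a(n)=F_{j+1}-a(n-F_j)$ if $F_j<n\le F_{j+1}$ with $j\ge 2$. -}

module Defs where

open import Data.Nat using (ℕ; zero; suc; _+_; _∸_; _<ᵇ_; _≤ᵇ_)
open import Data.Bool using (Bool; true; false; if_then_else_; _∧_)

F : ℕ → ℕ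
F zero = 0
F (suc zero) = 1
F (suc (suc n)) = F (suc n) + F n

-- findJ b j n : the least j' ≥ j (searching at most b steps) with n ≤ F (j'+1).
-- For n ≥ 2, starting at j = 2 with enough budget, this yields the unique
-- j ≥ 2 with F j < n ≤ F (j+1).
findJ : ℕ → ℕ → ℕ → ℕ
findJ zero j n = j
findJ (suc b) j n = if n ≤ᵇ F (suc j) then j else findJ b (suc j) n

-- fuelled version of A105774; fuel n is always enough since n - F j < n.
aF : ℕ → ℕ → ℕ
aF zero n = n
aF (suc fuel) zero = 0
aF (suc fuel) (suc zero) = 1
aF (suc fuel) (suc (suc m)) =
  let n = suc (suc m)
      j = findJ n 2 n
  in F (suc j) ∸ aF fuel (n ∸ F j)

-- A105774: a(n) = n for n ≤ 1, a(n) = F(j+1) - a(n - F j) for F j < n ≤ F (j+1), j ≥ 2.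
a : ℕ → ℕ
a n = aF n n

module Submission where

-- Every n ≥ 2 lies in a unique Fibonacci block F k < n ≤ F (k + 1), k ≥ 2, on which
-- a n = F (k + 1) ∸ a r with offset r = n ∸ F k ≤ F (k − 1). Strong induction gives
-- 0 < a n < F (k + 1). In the interior of the block r < F (k − 1), hence
-- a n > F (k + 1) − F (k − 1) = F k ≥ a (F k): the minimum is at F k, for every k.
-- The largest possible value F (k + 1) − 1 needs a r = 1; it is reached at r = 1, 2,
-- and nowhere else since a r ≥ 2 for r ≥ 3. For k ≥ 4 both points lie in the block
-- and a (F k) ≤ F k stays below it.

open import Defs
open import Data.Nat using (ℕ; zero; suc; pred; _+_; _∸_; _≤_; _<_; _≤ᵇ_; z≤n; s≤s; >-nonZero)
open import Data.Nat.Properties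
open import Data.Nat.Induction using (<-wellFounded)
open import Induction.WellFounded using (Acc; acc)
open import Data.Bool using (true; false)
open import Data.Product using (_×_; _,_; proj₁; proj₂)
open import Data.Sum using (_⊎_; inj₁; inj₂)
import Data.Sum as Sum
open import Data.Empty using (⊥-elim)
open import Relation.Nullary using (contradiction)
open import Relation.Nullary.Reflects using (ofʸ; ofⁿ)
open import Relation.Binary.PropositionalEquality
  using (_≡_; refl; sym; trans; cong; subst; subst₂; module ≡-Reasoning)

F[1+n]>0 : ∀ n → 0 < F (suc n)
F[1+n]>0 zero    = s≤s z≤n
F[1+n]>0 (suc n) = ≤-trans (F[1+n]>0 n) (m≤m+n _ _)

F[n]≤F[1+n] : ∀ n → F n ≤ F (suc n)
F[n]≤F[1+n] zero    = z≤n
F[n]≤F[1+n] (suc n) = m≤m+n _ _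

F-mono-≤ : ∀ {m n} → m ≤ n → F m ≤ F n
F-mono-≤ {n = zero}  z≤n = ≤-refl
F-mono-≤ {n = suc n} m≤1+n with m≤n⇒m<n∨m≡n m≤1+n
... | inj₂ refl   = ≤-refl
... | inj₁ m<1+n = ≤-trans (F-mono-≤ (≤-pred m<1+n)) (F[n]≤F[1+n] n)

F-cancel-< : ∀ {m n} → F m < F n → m < n
F-cancel-< Fm<Fn = ≰⇒> (λ n≤m → <⇒≱ Fm<Fn (F-mono-≤ n≤m))

n≤F[1+n] : ∀ n → n ≤ F (suc n)
n≤F[1+n] zero          = z≤n
n≤F[1+n] (suc zero)    = ≤-refl
n≤F[1+n] (suc (suc n)) =
  subst (_≤ F (suc (suc (suc n)))) (+-comm (suc n) 1)
        (+-mono-≤ (n≤F[1+n] (suc n)) (F[1+n]>0 n))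

F+≤F[1+k] : ∀ k {r} → r ≤ F (pred k) → F k + r ≤ F (suc k)
F+≤F[1+k] zero    r≤0 = ≤-trans r≤0 z≤n
F+≤F[1+k] (suc k) r≤  = +-monoʳ-≤ (F (suc k)) r≤

InBlock : ℕ → ℕ → Set
InBlock k n = F k < n × n ≤ F (suc k)

InBlock-unique : ∀ {j k n} → InBlock j n → InBlock k n → j ≡ k
InBlock-unique (Fj<n , n≤F[1+j]) (Fk<n , n≤F[1+k]) =
  ≤-antisym (≤-pred (F-cancel-< (<-≤-trans Fj<n n≤F[1+k])))
            (≤-pred (F-cancel-< (<-≤-trans Fk<n n≤F[1+j])))

findJ-InBlock : ∀ b i n → F i < n → n ≤ F (suc (b + i)) →
                i ≤ findJ b i n × InBlock (findJ b i n) n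
findJ-InBlock zero    i n Fi<n n≤ = ≤-refl , Fi<n , n≤
findJ-InBlock (suc b) i n Fi<n n≤ with n ≤ᵇ F (suc i) | ≤ᵇ-reflects-≤ n (F (suc i))
... | true  | ofʸ n≤F[1+i] = ≤-refl , Fi<n , n≤F[1+i]
... | false | ofⁿ n≰F[1+i] =
  let i<j , inBlock = findJ-InBlock b (suc i) n (≰⇒> n≰F[1+i])
                        (subst (λ x → n ≤ F (suc x)) (sym (+-suc b i)) n≤)
  in ≤-trans (n≤1+n i) i<j , inBlock

blockIndex : ℕ → ℕ
blockIndex n = findJ n 2 n

blockIndex-InBlock : ∀ n → 2 ≤ n → 2 ≤ blockIndex n × InBlock (blockIndex n) n
blockIndex-InBlock n 2≤n =
  findJ-InBlock n 2 n 2≤n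
    (subst (λ x → n ≤ F (suc x)) (+-comm 2 n)
           (≤-trans (n≤F[1+n] n) (F-mono-≤ (m≤n+m (suc n) 2))))

aF-fuel-irrelevant : ∀ n {f g} → n ≤ f → n ≤ g → aF f n ≡ aF g n
aF-fuel-irrelevant zero {zero}  {zero}  _ _ = refl
aF-fuel-irrelevant zero {zero}  {suc g} _ _ = refl
aF-fuel-irrelevant zero {suc f} {zero}  _ _ = refl
aF-fuel-irrelevant zero {suc f} {suc g} _ _ = refl
aF-fuel-irrelevant (suc zero) (s≤s _) (s≤s _) = refl
aF-fuel-irrelevant n@(suc (suc m)) (s≤s m<f) (s≤s m<g) =
  cong (F (suc j) ∸_) (aF-fuel-irrelevant (n ∸ F j) (≤-trans r≤ m<f) (≤-trans r≤ m<g))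
  where
  j : ℕ
  j = blockIndex n
  r≤ : n ∸ F j ≤ suc m
  r≤ = ∸-monoʳ-≤ n (F-mono-≤ (proj₁ (blockIndex-InBlock n (s≤s (s≤s z≤n)))))

a-block : ∀ {k n} → 2 ≤ k → InBlock k n → a n ≡ F (suc k) ∸ a (n ∸ F k)
a-block {n = zero} _ (() , _)
a-block {n = suc zero} 2≤k (Fk<1 , _) =
  ⊥-elim (<⇒≱ Fk<1 (F-mono-≤ (≤-trans (s≤s z≤n) 2≤k)))
a-block {k} {n@(suc (suc m))} 2≤k inBlock = begin
  a n                                ≡⟨⟩
  F (suc j) ∸ aF (suc m) (n ∸ F j)   ≡⟨ cong (λ i → F (suc i) ∸ aF (suc m) (n ∸ F i)) j≡k ⟩
  F (suc k) ∸ aF (suc m) (n ∸ F k)   ≡⟨ cong (F (suc k) ∸_) (aF-fuel-irrelevant (n ∸ F k) r≤ ≤-refl) ⟩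
  F (suc k) ∸ a (n ∸ F k)            ∎
  where
  open ≡-Reasoning
  j : ℕ
  j = blockIndex n
  j≡k : j ≡ k
  j≡k = InBlock-unique (proj₂ (blockIndex-InBlock n (s≤s (s≤s z≤n)))) inBlock
  r≤ : n ∸ F k ≤ suc m
  r≤ = ∸-monoʳ-≤ n (F-mono-≤ 2≤k)

a[F+r] : ∀ {k r} → 2 ≤ k → 0 < r → F k + r ≤ F (suc k) → a (F k + r) ≡ F (suc k) ∸ a r
a[F+r] {k} {r} 2≤k 0<r ≤F[1+k] =
  trans (a-block 2≤k (m<m+n (F k) 0<r , ≤F[1+k])) (cong (λ x → F (suc k) ∸ a x) (m+n∸m≡n (F k) r))

a-bounds : ∀ n → Acc _<_ n → 0 < n → 0 < a n × (∀ m → n < F m → a n < F m)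
a-bounds (suc zero) _ _ = s≤s z≤n , λ _ 1<Fm → 1<Fm
a-bounds n@(suc (suc _)) (acc rs) _ = 0<an , λ m n<Fm →
  <-≤-trans an<F[1+j] (F-mono-≤ {suc j} {m} (F-cancel-< (<-trans Fj<n n<Fm)))
  where
  j : ℕ
  j = blockIndex n
  spec : 2 ≤ j × InBlock j n
  spec = blockIndex-InBlock n (s≤s (s≤s z≤n))
  2≤j : 2 ≤ j
  2≤j = proj₁ spec
  Fj<n : F j < n
  Fj<n = proj₁ (proj₂ spec)
  n≤F[1+j] : n ≤ F (suc j)
  n≤F[1+j] = proj₂ (proj₂ spec)
  r : ℕ
  r = n ∸ F j
  r<n : r < n
  r<n = ∸-monoʳ-< (F-mono-≤ 2≤j) (<⇒≤ Fj<n)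
  ih : 0 < a r × (∀ m → r < F m → a r < F m)
  ih = a-bounds r (rs r<n) (m<n⇒0<n∸m Fj<n)
  ar<F[1+j] : a r < F (suc j)
  ar<F[1+j] = proj₂ ih (suc j) (<-≤-trans r<n n≤F[1+j])
  an≡ : a n ≡ F (suc j) ∸ a r
  an≡ = a-block 2≤j (Fj<n , n≤F[1+j])
  0<an : 0 < a n
  0<an = subst (0 <_) (sym an≡) (m<n⇒0<n∸m ar<F[1+j])
  an<F[1+j] : a n < F (suc j)
  an<F[1+j] = subst (_< F (suc j)) (sym an≡) (∸-monoʳ-< (proj₁ ih) (<⇒≤ ar<F[1+j]))

a-pos : ∀ {n} → 0 < n → 0 < a n
a-pos {n} 0<n = proj₁ (a-bounds n (<-wellFounded n) 0<n)

a<F : ∀ {n} m → 0 < n → n < F m → a n < F m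
a<F {n} m 0<n = proj₂ (a-bounds n (<-wellFounded n) 0<n) m

a-lower-bound : ∀ {k n} m → 2 ≤ k → InBlock k n → n ∸ F k < F m → F m ≤ F (suc k) →
                F (suc k) ∸ F m < a n
a-lower-bound {k} m 2≤k inBlock r<Fm Fm≤ =
  subst (F (suc k) ∸ F m <_) (sym (a-block 2≤k inBlock))
        (∸-monoʳ-< (a<F m (m<n⇒0<n∸m (proj₁ inBlock)) r<Fm) Fm≤)

F<a : ∀ k {n} → F k < n → n < F (suc k) → F k < a n
F<a zero          0<n n<1 = ⊥-elim (<⇒≱ n<1 0<n)
F<a (suc zero)    1<n n<1 = ⊥-elim (<⇒≱ n<1 (<⇒≤ 1<n))
F<a k@(suc (suc i)) {n} Fk<n n<F[1+k] =
  subst (_< a n) (m+n∸n≡m (F k) (F (suc i)))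
    (a-lower-bound {k} (suc i) (s≤s (s≤s z≤n)) (Fk<n , <⇒≤ n<F[1+k])
       (m<n+o⇒m∸n<o n (F k) {{>-nonZero (F[1+n]>0 i)}} n<F[1+k])
       (F-mono-≤ (m≤n+m (suc i) 2)))

2≤a : ∀ {n} → 3 ≤ n → 2 ≤ a n
2≤a {n} 3≤n with blockIndex n | blockIndex-InBlock n (≤-trans (n≤1+n 2) 3≤n)
... | zero | () , _
... | suc zero | s≤s () , _
... | suc (suc zero) | _ , _ , n≤2 = ⊥-elim (<⇒≱ 3≤n n≤2)
... | j@(suc (suc (suc i))) | 2≤j , inBlock@(_ , n≤F[1+j]) =
  ≤-<-trans (F[1+n]>0 (suc i))
    (subst (_< a n) (m+n∸m≡n (F j) (F (suc (suc i))))
      (a-lower-bound {j} j 2≤j inBlock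
         (≤-<-trans (m≤n+o⇒m∸n≤o n (F j) n≤F[1+j]) (m<m+n (F (suc (suc i))) (F[1+n]>0 i)))
         (F[n]≤F[1+n] j)))

a[F]≤F : ∀ k → a (F k) ≤ F k
a[F]≤F zero             = z≤n
a[F]≤F (suc zero)       = ≤-refl
a[F]≤F (suc (suc zero)) = ≤-refl
a[F]≤F k@(suc (suc (suc i))) =
  subst (_≤ F k)
    (sym (a-block {suc (suc i)} (s≤s (s≤s z≤n)) (m<m+n (F (suc (suc i))) (F[1+n]>0 i) , ≤-refl)))
    (m∸n≤m (F k) (a (F k ∸ F (suc (suc i)))))

a-minimum : ∀ k n → F k ≤ n → n < F (suc k) →
            (a (F k) ≤ a n) × (a n ≡ a (F k) → n ≡ F k)
a-minimum k n Fk≤n n<F[1+k] with m≤n⇒m<n∨m≡n Fk≤n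
... | inj₂ refl = ≤-refl , λ _ → refl
... | inj₁ Fk<n = <⇒≤ aFk<an , λ an≡aFk → contradiction (sym an≡aFk) (<⇒≢ aFk<an)
  where
  aFk<an : a (F k) < a n
  aFk<an = ≤-<-trans (a[F]≤F k) (F<a k Fk<n n<F[1+k])

0<r≤2⇒r≡1⊎r≡2 : ∀ {r} → 0 < r → r ≤ 2 → r ≡ 1 ⊎ r ≡ 2
0<r≤2⇒r≡1⊎r≡2 {zero} () _
0<r≤2⇒r≡1⊎r≡2 {suc zero}          _ _ = inj₁ refl
0<r≤2⇒r≡1⊎r≡2 {suc (suc zero)}    _ _ = inj₂ refl
0<r≤2⇒r≡1⊎r≡2 {suc (suc (suc _))} _ (s≤s (s≤s ()))

a-maximum : ∀ k → 4 ≤ k →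
    ((n : ℕ) → F k ≤ n → n < F (suc k) → a n ≤ a (F k + 1))
  × (a (F k + 2) ≡ a (F k + 1))
  × ((n : ℕ) → F k ≤ n → n < F (suc k) → a n ≡ a (F k + 1) → (n ≡ F k + 1) ⊎ (n ≡ F k + 2))
a-maximum k 4≤k = below-a[F+1] , trans a[F+2]≡ (sym a[F+1]≡) , only-F+1-F+2
  where
  2≤k : 2 ≤ k
  2≤k = ≤-trans (s≤s (s≤s z≤n)) 4≤k
  2≤F[k-1] : 2 ≤ F (pred k)
  2≤F[k-1] = F-mono-≤ {3} (pred-mono-≤ 4≤k)
  top : ℕ
  top = F (suc k) ∸ 1
  a[F+1]≡ : a (F k + 1) ≡ top
  a[F+1]≡ = a[F+r] 2≤k (s≤s z≤n) (F+≤F[1+k] k (≤-trans (s≤s z≤n) 2≤F[k-1]))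
  a[F+2]≡ : a (F k + 2) ≡ top
  a[F+2]≡ = a[F+r] 2≤k (s≤s z≤n) (F+≤F[1+k] k 2≤F[k-1])
  aFk<top : a (F k) < top
  aFk<top = ≤-<-trans (a[F]≤F k)
    (m+n≤o⇒m≤o∸n (suc (F k)) (subst (_≤ F (suc k)) (+-suc (F k) 1) (F+≤F[1+k] k 2≤F[k-1])))

  below-a[F+1] : (n : ℕ) → F k ≤ n → n < F (suc k) → a n ≤ a (F k + 1)
  below-a[F+1] n Fk≤n n<F[1+k] with m≤n⇒m<n∨m≡n Fk≤n
  ... | inj₂ refl = subst (a (F k) ≤_) (sym a[F+1]≡) (<⇒≤ aFk<top)
  ... | inj₁ Fk<n = subst₂ _≤_ (sym (a-block 2≤k (Fk<n , <⇒≤ n<F[1+k]))) (sym a[F+1]≡)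
                      (∸-monoʳ-≤ (F (suc k)) (a-pos (m<n⇒0<n∸m Fk<n)))

  only-F+1-F+2 : (n : ℕ) → F k ≤ n → n < F (suc k) → a n ≡ a (F k + 1) →
                 (n ≡ F k + 1) ⊎ (n ≡ F k + 2)
  only-F+1-F+2 n Fk≤n n<F[1+k] an≡ with m≤n⇒m<n∨m≡n Fk≤n
  ... | inj₂ refl = contradiction (trans an≡ a[F+1]≡) (<⇒≢ aFk<top)
  ... | inj₁ Fk<n = Sum.map n≡F+ n≡F+ (0<r≤2⇒r≡1⊎r≡2 (m<n⇒0<n∸m Fk<n) r≤2)
    where
    r : ℕ
    r = n ∸ F k
    n≡F+ : ∀ {d} → r ≡ d → n ≡ F k + d
    n≡F+ r≡d = trans (sym (m+[n∸m]≡n Fk≤n)) (cong (F k +_) r≡d)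
    r≤2 : r ≤ 2
    r≤2 = ≤-pred (≰⇒> λ 3≤r →
      <⇒≢ (∸-monoʳ-< (2≤a 3≤r) (<⇒≤ (a<F (suc k) (m<n⇒0<n∸m Fk<n) (≤-<-trans (m∸n≤m n (F k)) n<F[1+k]))))
          (trans (sym (a-block 2≤k (Fk<n , <⇒≤ n<F[1+k]))) (trans an≡ a[F+1]≡)))

proposition14 :
    ((k : ℕ) → 3 ≤ k → (n : ℕ) → F k ≤ n → n < F (k + 1) →
       (a (F k) ≤ a n) × (a n ≡ a (F k) → n ≡ F k))
    ×
    ((k : ℕ) → 5 ≤ k →
       ((n : ℕ) → F k ≤ n → n < F (k + 1) → a n ≤ a (F k + 1))
       × (a (F k + 2) ≡ a (F k + 1))
       × ((n : ℕ) → F k ≤ n → n < F (k + 1) → a n ≡ a (F k + 1) →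
            (n ≡ F k + 1) ⊎ (n ≡ F k + 2)))
proposition14 =
  (λ k _ n Fk≤n n<F[k+1] → a-minimum k n Fk≤n (F[k+1]⇒F[1+k] {k = k} n<F[k+1])) ,
  λ k 5≤k → let below , tie , only = a-maximum k (<⇒≤ 5≤k) in
    (λ n Fk≤n n<F[k+1] → below n Fk≤n (F[k+1]⇒F[1+k] {k = k} n<F[k+1])) ,
    tie ,
    (λ n Fk≤n n<F[k+1] → only n Fk≤n (F[k+1]⇒F[1+k] {k = k} n<F[k+1]))
  where
  F[k+1]⇒F[1+k] : ∀ {n k} → n < F (k + 1) → n < F (suc k)
  F[k+1]⇒F[1+k] {n} {k} = subst (λ m → n < F m) (+-comm k 1)
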